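{- Every involution-free proper mosaic $(H,x)$ contains a 2,3-path.
   Context: Graphs are finite and simple. A rooted graph $(H,x)$ is a graph with a distinguished vertex $x$; it is involution-free if $H$ has no automorphism of order $2$ fixing $x$. A cactus graph is a connected simple graph in which every edge lies on at most one cycle. An unbristled mosaic is either the one-vertex rooted graph or a rooted cactus graph which is a union of 4-cycles. A mosaic is a rooted graph $(H,x)$ for which there is a partition $(V',V'')$ of $V(H)$ with $x\in V'$, $(H[V'],x)$ an unbristled mosaic, and $E(H)\setminus E(H[V'])$ a perfect matching between $V''$ and a subset of $V'$ (these edges are called bristles). A proper mosaic is a mosaic containing at least one cycle. A 2,3-path in a rooted graph $(H,x)$ is a tuple $(P,v_2,v_3)$ where $P$ is a path starting at $x$ (possibly the single vertex $x$), $v_2,v_3$ lie on a common cycle of $H$, and for $j\in\{2,3\}$, $\deg_H(v_j)=j$ and the path $Pv_j$ (i.e. $P$ extended by an edge from its last vertex to $v_j$) is the unique shortest $x$--$v_j$ path in $H$. -}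

module Defs where

open import Data.Nat using (ℕ; _≤_)
open import Data.Fin using (Fin)
open import Data.Bool using (Bool; true; false)
open import Data.List using (List; []; _∷_; _++_; [_]; length; take; head; last; allFin; filterᵇ)
open import Data.List.Relation.Unary.All using (All)
open import Data.List.Relation.Unary.Linked using (Linked)
open import Data.List.Relation.Unary.Unique.Propositional using (Unique)
open import Data.List.Membership.Propositional using (_∈_)
open import Data.Maybe using (just)
open import Data.Product using (Σ; ∃; ∃-syntax; _×_; _,_)
open import Data.Sum using (_⊎_)
open import Relation.Binary.PropositionalEquality using (_≡_; _≢_)
open import Relation.Nullary using (¬_)

record Graph : Set where
  field
    n     : ℕ
    adj   : Fin n → Fin n → Bool
    sym   : ∀ u v → adj u v ≡ adj v u
    irref : ∀ v → adj v v ≡ false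

module _ (G : Graph) where
  open Graph G

  Vtx : Set
  Vtx = Fin n

  E : Vtx → Vtx → Set
  E u v = adj u v ≡ true

  In : (Vtx → Bool) → Vtx → Set
  In S v = S v ≡ true

  degree : Vtx → ℕ
  degree v = length (filterᵇ (adj v) (allFin n))

  IsPath : List Vtx → Set
  IsPath p = Unique p × Linked E p

  PathFromTo : Vtx → Vtx → List Vtx → Set
  PathFromTo u v p = IsPath p × head p ≡ just u × last p ≡ just v

  closed : List Vtx → List Vtx
  closed c = c ++ take 1 c

  IsCycle : List Vtx → Set
  IsCycle c = 3 ≤ length c × Unique c × Linked E (closed c)

  Consec : Vtx → Vtx → List Vtx → Set
  Consec a b l = ∃[ xs ] ∃[ ys ] l ≡ xs ++ a ∷ b ∷ ys

  CycEdge : List Vtx → Vtx → Vtx → Set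
  CycEdge c a b = Consec a b (closed c) ⊎ Consec b a (closed c)

  -- two cycle presentations describe the same cycle (same edge set)
  SameCycle : List Vtx → List Vtx → Set
  SameCycle c d = ∀ a b → (CycEdge c a b → CycEdge d a b) × (CycEdge d a b → CycEdge c a b)

  CycleIn : (Vtx → Bool) → List Vtx → Set
  CycleIn S c = IsCycle c × All (In S) c

  ConnectedIn : (Vtx → Bool) → Set
  ConnectedIn S = ∀ u v → In S u → In S v → ∃[ p ] (PathFromTo u v p × All (In S) p)

  CactusIn : (Vtx → Bool) → Set
  CactusIn S = ConnectedIn S ×
    (∀ a b → In S a → In S b → E a b → ∀ c d → CycleIn S c → CycleIn S d →
       CycEdge c a b → CycEdge d a b → SameCycle c d)

  UnionOf4CyclesIn : (Vtx → Bool) → Set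
  UnionOf4CyclesIn S =
    (∀ v → In S v → ∃[ c ] (CycleIn S c × length c ≡ 4 × v ∈ c)) ×
    (∀ a b → In S a → In S b → E a b → ∃[ c ] (CycleIn S c × length c ≡ 4 × CycEdge c a b))

  UnbristledMosaicIn : (Vtx → Bool) → Vtx → Set
  UnbristledMosaicIn S x =
    (∀ v → (In S v → v ≡ x) × (v ≡ x → In S v))
    ⊎ (In S x × CactusIn S × UnionOf4CyclesIn S)

  -- the edges of H not in H[S] form a perfect matching between the complement of S
  -- and a subset of S
  Bristles : (Vtx → Bool) → Set
  Bristles S =
    (∀ a b → E a b → In S a ⊎ In S b) ×
    (∀ v → ¬ In S v → ∃[ w ] (E v w × (∀ w' → E v w' → w' ≡ w))) ×
    (∀ u w₁ w₂ → In S u → ¬ In S w₁ → ¬ In S w₂ → E u w₁ → E u w₂ → w₁ ≡ w₂)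

  Mosaic : Vtx → Set
  Mosaic x = ∃[ S ] (In S x × UnbristledMosaicIn S x × Bristles S)

  ProperMosaic : Vtx → Set
  ProperMosaic x = Mosaic x × ∃[ c ] IsCycle c

  InvolutionFree : Vtx → Set
  InvolutionFree x = ¬ (Σ (Vtx → Vtx) λ σ → ((∀ v → σ (σ v) ≡ v) × (∃[ v ] σ v ≢ v) × σ x ≡ x ×
                                 (∀ u v → adj (σ u) (σ v) ≡ adj u v)))

  UniqueShortest : Vtx → Vtx → List Vtx → Set
  UniqueShortest u v p = PathFromTo u v p ×
    (∀ q → PathFromTo u v q → length q ≤ length p → q ≡ p)

  Is23Path : Vtx → List Vtx → Vtx → Vtx → Set
  Is23Path x P v₂ v₃ =
    IsPath P × head P ≡ just x ×
    (∃[ c ] (IsCycle c × v₂ ∈ c × v₃ ∈ c)) ×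
    degree v₂ ≡ 2 × degree v₃ ≡ 3 ×
    (∃[ y ] (last P ≡ just y × E y v₂)) × UniqueShortest x v₂ (P ++ [ v₂ ]) ×
    (∃[ y ] (last P ≡ just y × E y v₃)) × UniqueShortest x v₃ (P ++ [ v₃ ])

  Has23Path : Vtx → Set
  Has23Path x = ∃[ P ] ∃[ v₂ ] ∃[ v₃ ] Is23Path x P v₂ v₃

-- Let S be the vertex set of the unbristled part. Every vertex of degree at least 2 lies in S, so if S = {x}
-- there is no cycle. Otherwise walk from x through the 4-cycles (squares) of the cactus H[S], keeping a unique
-- shortest path P from x to a vertex a of the current square a b c d whose last edge y a is not on that
-- square. A second shortest path to b or d would close a cycle through y a and an edge of the square at a;
-- as no edge of a cactus lies on two cycles, this cycle would be the square, which does not contain y a.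
-- So P b and P d are unique shortest paths. If b or d has a neighbour in S off the square, the walk moves on
-- to the square containing that edge. Otherwise b and d have degree 2 (no bristle) or 3 (one bristle);
-- equal degrees would make swapping b with d (and their bristles) an automorphism of order 2 fixing x,
-- so one has degree 2, the other degree 3, and (P, b, d) is a 2,3-path. The walk ends since P grows.

module Submission where

open import Defs
open import Data.Nat using (ℕ; zero; suc; _+_; _≤_; _<_; z≤n; s≤s)
open import Data.Nat.Properties
  using (≤-antisym; ≤-trans; ≤-refl; <⇒≱; +-suc; +-comm; +-identityʳ; +-cancelˡ-≤; +-cancelʳ-≤; +-monoʳ-≤;
         m≤n+m)
open import Data.Fin using (Fin; _≟_)
import Data.Fin.Properties as Fin
open import Data.Fin.Permutation.Components using (transpose)
open import Data.Bool using (Bool; true)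
open import Data.Bool.Properties using (T-≡; ⇔→≡) renaming (_≟_ to _≟ᵇ_)
open import Data.List
  using (List; []; _∷_; _++_; [_]; _∷ʳ_; length; head; last; reverse; allFin; filter)
open import Data.List.Properties
  using (++-assoc; length-++; unfold-reverse; reverse-++; length-removeAt′; length-tabulate; ∷ʳ-++)
open import Data.List.Relation.Unary.All as All using (All; []; _∷_)
import Data.List.Relation.Unary.All.Properties as Allₚ
open import Data.List.Relation.Unary.AllPairs using ([]; _∷_)
open import Data.List.Relation.Unary.Any using (Any; here; there; any?; _─_)
import Data.List.Relation.Unary.Any.Properties as Anyₚ
open import Data.List.Relation.Unary.Linked using (Linked; []; [-]; _∷_)
import Data.List.Relation.Unary.Linked.Properties as Linked
open import Data.List.Relation.Unary.Unique.Propositional using (Unique)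
import Data.List.Relation.Unary.Unique.Propositional.Properties as Uniqueₚ
open import Data.List.Relation.Binary.Permutation.Propositional using (↭⇒↭ₛ; ↭-sym)
open import Data.List.Relation.Binary.Permutation.Propositional.Properties using (↭-reverse)
import Data.List.Relation.Binary.Permutation.Setoid.Properties as Permutationₛ
open import Data.List.Membership.Propositional using (_∈_; _∉_)
open import Data.List.Membership.Propositional.Properties
  using (∈-filter⁺; ∈-filter⁻; ∈-allFin; ∈-++⁻; ∈-++⁺ʳ; ∈-∃++)
open import Data.Maybe using (just)
open import Data.Maybe.Properties using (just-injective)
open import Data.Maybe.Relation.Binary.Connected using (Connected; just; nothing-just)
open import Data.Product using (Σ-syntax; ∃; ∃-syntax; _×_; _,_; proj₁; proj₂)
open import Data.Sum as Sum using (_⊎_; inj₁; inj₂; swap)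
open import Data.Empty using (⊥; ⊥-elim)
open import Function using (_∘_; id; case_of_)
open import Function.Bundles using (Equivalence; mk⇔)
open import Relation.Binary.PropositionalEquality
  using (_≡_; _≢_; refl; sym; trans; cong; subst; subst₂; setoid)
open import Relation.Nullary using (¬_; Dec; yes; no)
open import Relation.Nullary.Decidable using (T?; dec-true; dec-false; _×-dec_; ¬?; decidable-stable)
open import Relation.Unary using (Decidable)

module _ {A : Set} where

  last-∷ʳ : ∀ (xs : List A) {x} → last (xs ∷ʳ x) ≡ just x
  last-∷ʳ []           = refl
  last-∷ʳ (_ ∷ [])     = refl
  last-∷ʳ (_ ∷ y ∷ xs) = last-∷ʳ (y ∷ xs)

  last⇒∷ʳ : ∀ (xs : List A) {y} → last xs ≡ just y → ∃[ ys ] xs ≡ ys ∷ʳ y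
  last⇒∷ʳ (x ∷ [])     refl = [] , refl
  last⇒∷ʳ (x ∷ z ∷ xs) eq with ys , eq′ ← last⇒∷ʳ (z ∷ xs) eq = x ∷ ys , cong (x ∷_) eq′

  last-reverse : ∀ (xs : List A) → last (reverse xs) ≡ head xs
  last-reverse []       = refl
  last-reverse (x ∷ xs) rewrite unfold-reverse x xs = last-∷ʳ (reverse xs)

  Unique-reverse : ∀ {xs : List A} → Unique xs → Unique (reverse xs)
  Unique-reverse {xs} = Permutationₛ.Unique-resp-↭ (setoid A) (↭⇒↭ₛ (↭-sym (↭-reverse xs)))

  Unique-++⁻ˡ : ∀ (xs : List A) {ys} → Unique (xs ++ ys) → Unique xs
  Unique-++⁻ˡ []       _       = []
  Unique-++⁻ˡ (_ ∷ xs) (d ∷ u) = Allₚ.++⁻ˡ xs d ∷ Unique-++⁻ˡ xs u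

  Unique-++⁻ʳ : ∀ (xs : List A) {ys} → Unique (xs ++ ys) → Unique ys
  Unique-++⁻ʳ []       u       = u
  Unique-++⁻ʳ (_ ∷ xs) (_ ∷ u) = Unique-++⁻ʳ xs u

  Unique-length-≤ : ∀ {xs ys : List A} → Unique xs → (∀ {v} → v ∈ xs → v ∈ ys) → length xs ≤ length ys
  Unique-length-≤ {[]}     _       _   = z≤n
  Unique-length-≤ {x ∷ xs} {ys} (x∉xs ∷ u) xs⊆ys =
    subst (suc (length xs) ≤_) (sym (length-removeAt′ ys _))
      (s≤s (Unique-length-≤ u (λ v∈xs → ∈-─ ys x∈ys (xs⊆ys (there v∈xs)) (All.lookup x∉xs v∈xs ∘ sym))))
    where
    x∈ys : x ∈ ys
    x∈ys = xs⊆ys (here refl)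
    ∈-─ : ∀ {v w} zs (v∈zs : v ∈ zs) → w ∈ zs → w ≢ v → w ∈ (zs ─ v∈zs)
    ∈-─ (z ∷ zs) (here refl) (here refl)  w≢v = ⊥-elim (w≢v refl)
    ∈-─ (z ∷ zs) (here refl) (there w∈zs) _   = w∈zs
    ∈-─ (z ∷ zs) (there _)   (here refl)  _   = here refl
    ∈-─ (z ∷ zs) (there v∈zs) (there w∈zs) w≢v = there (∈-─ zs v∈zs w∈zs w≢v)

  module _ {R : A → A → Set} where

    Linked-++⁻ˡ : ∀ (xs : List A) {ys} → Linked R (xs ++ ys) → Linked R xs
    Linked-++⁻ˡ []           _       = []
    Linked-++⁻ˡ (_ ∷ [])     _       = [-]
    Linked-++⁻ˡ (_ ∷ y ∷ xs) (r ∷ l) = r ∷ Linked-++⁻ˡ (y ∷ xs) l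

    Linked-++⁻ʳ : ∀ (xs : List A) {ys} → Linked R (xs ++ ys) → Linked R ys
    Linked-++⁻ʳ []           l       = l
    Linked-++⁻ʳ (_ ∷ [])     [-]     = []
    Linked-++⁻ʳ (_ ∷ [])     (_ ∷ l) = l
    Linked-++⁻ʳ (_ ∷ y ∷ xs) (_ ∷ l) = Linked-++⁻ʳ (y ∷ xs) l

    Linked-∷ʳ : ∀ {xs : List A} {y z} → Linked R xs → last xs ≡ just y → R y z → Linked R (xs ∷ʳ z)
    Linked-∷ʳ {z = z} l eq r = Linked.++⁺ l (subst (λ m → Connected R m (just z)) (sym eq) (just r)) [-]

    Linked-reverse : (∀ {u v} → R u v → R v u) → ∀ {xs} → Linked R xs → Linked R (reverse xs)
    Linked-reverse _     []                     = []
    Linked-reverse _     [-]                    = [-]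
    Linked-reverse R-sym {x ∷ y ∷ xs} (r ∷ l) rewrite unfold-reverse x (y ∷ xs) =
      Linked-∷ʳ (Linked-reverse R-sym l) (last-reverse (y ∷ xs)) (R-sym r)

  length-∷ʳ : ∀ (xs : List A) {x} → length (xs ∷ʳ x) ≡ suc (length xs)
  length-∷ʳ xs = trans (length-++ xs) (+-comm (length xs) 1)

  head-++ : ∀ {xs ys : List A} {z} → head xs ≡ just z → head (xs ++ ys) ≡ just z
  head-++ {_ ∷ _} eq = eq

  last-++-∷ : ∀ (xs : List A) {y} ys → last (xs ++ y ∷ ys) ≡ last (y ∷ ys)
  last-++-∷ []           _  = refl
  last-++-∷ (_ ∷ [])     _  = refl
  last-++-∷ (_ ∷ x ∷ xs) ys = last-++-∷ (x ∷ xs) ys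

  head⇒Any : ∀ {Q : A → Set} {xs z} → head xs ≡ just z → Q z → Any Q xs
  head⇒Any {xs = _ ∷ _} refl qz = here qz

  last-++-∷ʳ : ∀ (xs ys : List A) {y} → last (xs ++ ys ∷ʳ y) ≡ just y
  last-++-∷ʳ xs ys {y} rewrite sym (++-assoc xs ys [ y ]) = last-∷ʳ (xs ++ ys)

  head-++-∷ : ∀ (xs : List A) {z ys} → head (xs ++ z ∷ ys) ≡ head (xs ∷ʳ z)
  head-++-∷ []      = refl
  head-++-∷ (_ ∷ _) = refl

  split-at-last : ∀ {Q : A → Set} → Decidable Q → ∀ {xs} → Any Q xs →
                  ∃[ ys ] ∃[ z ] ∃[ zs ] (xs ≡ ys ++ z ∷ zs × Q z × All (¬_ ∘ Q) zs)
  split-at-last Q? {x ∷ xs} q with any? Q? xs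
  ... | yes q′ with ys , z , zs , eq , qz , ¬qzs ← split-at-last Q? q′ = x ∷ ys , z , zs , cong (x ∷_) eq , qz , ¬qzs
  ... | no ¬q′ with q
  ...   | here qx  = [] , x , xs , refl , qx , Allₚ.¬Any⇒All¬ xs ¬q′
  ...   | there q′ = ⊥-elim (¬q′ q′)

module _ (G : Graph) where
  open Graph G using (n; adj; irref) renaming (sym to adj-sym)

  E-sym : ∀ {u v} → E G u v → E G v u
  E-sym {u} {v} e = trans (adj-sym v u) e

  E-irrefl : ∀ {v} → ¬ E G v v
  E-irrefl {v} e with () ← trans (sym (irref v)) e

  E-resp : ∀ {u u′ w w′} → u ≡ u′ → w ≡ w′ → E G u′ w′ → E G u w
  E-resp u≡u′ w≡w′ = subst₂ (E G) (sym u≡u′) (sym w≡w′)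

  E⇒≢ : ∀ {u v} → E G u v → u ≢ v
  E⇒≢ e refl = E-irrefl e

  degree-≡ : ∀ {b} ws → Unique ws → All (E G b) ws → (∀ {w} → E G b w → w ∈ ws) → degree G b ≡ length ws
  degree-≡ {b} ws ws-unique ws-adjacent ws-complete =
    ≤-antisym (Unique-length-≤ (Uniqueₚ.filter⁺ (T? ∘ adj b) (Uniqueₚ.allFin⁺ n)) (ws-complete ∘ neighbour⁻))
              (Unique-length-≤ ws-unique (neighbour⁺ ∘ All.lookup ws-adjacent))
    where
    neighbour⁺ : ∀ {w} → E G b w → w ∈ filter (T? ∘ adj b) (allFin n)
    neighbour⁺ {w} e = ∈-filter⁺ (T? ∘ adj b) (∈-allFin w) (Equivalence.from T-≡ e)
    neighbour⁻ : ∀ {w} → w ∈ filter (T? ∘ adj b) (allFin n) → E G b w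
    neighbour⁻ m = Equivalence.to T-≡ (proj₂ (∈-filter⁻ (T? ∘ adj b) {xs = allFin n} m))

  IsPath-++⁻ˡ : ∀ xs {ys} → IsPath G (xs ++ ys) → IsPath G xs
  IsPath-++⁻ˡ xs (u , l) = Unique-++⁻ˡ xs u , Linked-++⁻ˡ xs l

  IsPath-++⁻ʳ : ∀ xs {ys} → IsPath G (xs ++ ys) → IsPath G ys
  IsPath-++⁻ʳ xs (u , l) = Unique-++⁻ʳ xs u , Linked-++⁻ʳ xs l

  length-≤-n : ∀ {p} → IsPath G p → length p ≤ n
  length-≤-n {p} (u , _) = subst (length p ≤_) (length-tabulate id) (Unique-length-≤ u (λ {v} _ → ∈-allFin v))

  path-closes-to-cycle : ∀ {v y a} L → IsPath G (v ∷ L ++ y ∷ a ∷ []) → E G a v →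
    IsCycle G (v ∷ L ++ y ∷ a ∷ []) × CycEdge G (v ∷ L ++ y ∷ a ∷ []) y a × CycEdge G (v ∷ L ++ y ∷ a ∷ []) a v
  path-closes-to-cycle {v} {y} {a} L (u , l) e =
    (s≤s (subst (2 ≤_) (sym (length-++ L)) (m≤n+m 2 (length L))) , u , Linked-∷ʳ l (last-++-∷ʳ (v ∷ L) [ y ]) e) ,
    inj₁ (v ∷ L , [ v ] , cong (v ∷_) (++-assoc L (y ∷ a ∷ []) [ v ])) ,
    inj₁ (v ∷ L ∷ʳ y , [] , cong (v ∷_) (trans (++-assoc L (y ∷ a ∷ []) [ v ]) (sym (++-assoc L [ y ] (a ∷ v ∷ [])))))

  IsPath-∷ʳ : ∀ {P a v} → IsPath G P → last P ≡ just a → E G a v → v ∉ P → IsPath G (P ∷ʳ v)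
  IsPath-∷ʳ (u , l) last≡a av v∉P =
    Uniqueₚ.++⁺ u ([] ∷ []) (λ { (v∈P , here refl) → v∉P v∈P }) , Linked-∷ʳ l last≡a av

  IsPath-reverse-++ : ∀ {z r s} → IsPath G (z ∷ r) → IsPath G s → head s ≡ just z →
    (∀ {w} → w ∈ r → w ∉ s) → IsPath G (reverse r ++ s)
  IsPath-reverse-++ {z} {r} {s} ((_ ∷ r-unique) , zr) (s-unique , s-linked) head≡z r∉s =
    Uniqueₚ.++⁺ (Unique-reverse r-unique) s-unique (λ (w∈r , w∈s) → r∉s (Anyₚ.reverse⁻ w∈r) w∈s) ,
    Linked.++⁺ (Linked-reverse E-sym (Linked-++⁻ʳ [ z ] zr))
               (subst₂ (Connected (E G)) (sym (last-reverse r)) (sym head≡z) (joint r zr)) s-linked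
    where
    joint : ∀ r → Linked (E G) (z ∷ r) → Connected (E G) (head r) (just z)
    joint []      _        = nothing-just
    joint (_ ∷ _) (zh ∷ _) = just (E-sym zh)

  degree-2 : ∀ {b a c} → E G b a → E G b c → a ≢ c → (∀ {w} → E G b w → w ≡ a ⊎ w ≡ c) → degree G b ≡ 2
  degree-2 ba bc a≢c N[b] =
    degree-≡ (_ ∷ _ ∷ []) ((a≢c ∷ []) ∷ [] ∷ []) (ba ∷ bc ∷ []) (λ bw → case N[b] bw of λ where
      (inj₁ w≡a) → here w≡a
      (inj₂ w≡c) → there (here w≡c))

  degree-3 : ∀ {b a c w} → E G b a → E G b c → E G b w → a ≢ c → a ≢ w → c ≢ w →
             (∀ {w′} → E G b w′ → w′ ≡ a ⊎ w′ ≡ c ⊎ w′ ≡ w) → degree G b ≡ 3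
  degree-3 ba bc bw a≢c a≢w c≢w N[b] =
    degree-≡ (_ ∷ _ ∷ _ ∷ []) ((a≢c ∷ a≢w ∷ []) ∷ (c≢w ∷ []) ∷ [] ∷ []) (ba ∷ bc ∷ bw ∷ [])
      (λ bw′ → case N[b] bw′ of λ where
        (inj₁ w′≡a)        → here w′≡a
        (inj₂ (inj₁ w′≡c)) → there (here w′≡c)
        (inj₂ (inj₂ w′≡w)) → there (there (here w′≡w)))

  root-shortest : ∀ {x} → UniqueShortest G x x [ x ]
  root-shortest = ((([] ∷ []) , [-]) , refl , refl) , λ where
    (_ ∷ [])     (_ , refl , _) _       → refl
    (_ ∷ _ ∷ _)  _              (s≤s ())

  Has23Path-intro : ∀ {x P a v₂ v₃ c} → UniqueShortest G x a P → IsCycle G c → v₂ ∈ c → v₃ ∈ c →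
    E G a v₂ → E G a v₃ → degree G v₂ ≡ 2 → degree G v₃ ≡ 3 →
    UniqueShortest G x v₂ (P ∷ʳ v₂) → UniqueShortest G x v₃ (P ∷ʳ v₃) → Has23Path G x
  Has23Path-intro ((p , head≡x , last≡a) , _) c-cycle v₂∈c v₃∈c av₂ av₃ deg₂ deg₃ shortest₂ shortest₃ =
    _ , _ , _ , p , head≡x , (_ , c-cycle , v₂∈c , v₃∈c) , deg₂ , deg₃ ,
    (_ , last≡a , av₂) , shortest₂ , (_ , last≡a , av₃) , shortest₃

module Squares {G : Graph} (S : Vtx G → Bool) where

  data Side (a b c d : Vtx G) : Vtx G → Vtx G → Set where
    ab : Side a b c d a b
    bc : Side a b c d b c
    cd : Side a b c d c d
    da : Side a b c d d a

  SquareEdge : Vtx G → Vtx G → Vtx G → Vtx G → Vtx G → Vtx G → Set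
  SquareEdge a b c d u v = Side a b c d u v ⊎ Side a b c d v u

  private
    Consec⇒Side : ∀ {a b c d u v} → Consec G u v (a ∷ b ∷ c ∷ d ∷ a ∷ []) → Side a b c d u v
    Consec⇒Side ([]                        , _ , refl) = ab
    Consec⇒Side (_ ∷ []                    , _ , refl) = bc
    Consec⇒Side (_ ∷ _ ∷ []                , _ , refl) = cd
    Consec⇒Side (_ ∷ _ ∷ _ ∷ []            , _ , refl) = da
    Consec⇒Side (_ ∷ _ ∷ _ ∷ _ ∷ []        , _ , ())
    Consec⇒Side (_ ∷ _ ∷ _ ∷ _ ∷ _ ∷ []    , _ , ())
    Consec⇒Side (_ ∷ _ ∷ _ ∷ _ ∷ _ ∷ _ ∷ _ , _ , ())

    Side⇒Consec : ∀ {a b c d u v} → Side a b c d u v → Consec G u v (a ∷ b ∷ c ∷ d ∷ a ∷ [])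
    Side⇒Consec {a}         ab = []              , _  , refl
    Side⇒Consec {a}         bc = a ∷ []          , _  , refl
    Side⇒Consec {a} {b}     cd = a ∷ b ∷ []      , _  , refl
    Side⇒Consec {a} {b} {c} da = a ∷ b ∷ c ∷ []  , [] , refl

  CycEdge⇒SquareEdge : ∀ {a b c d u v} → CycEdge G (a ∷ b ∷ c ∷ d ∷ []) u v → SquareEdge a b c d u v
  CycEdge⇒SquareEdge (inj₁ c) = inj₁ (Consec⇒Side c)
  CycEdge⇒SquareEdge (inj₂ c) = inj₂ (Consec⇒Side c)

  SquareEdge⇒CycEdge : ∀ {a b c d u v} → SquareEdge a b c d u v → CycEdge G (a ∷ b ∷ c ∷ d ∷ []) u v
  SquareEdge⇒CycEdge (inj₁ s) = inj₁ (Side⇒Consec s)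
  SquareEdge⇒CycEdge (inj₂ s) = inj₂ (Side⇒Consec s)

  Side-rotate : ∀ {a b c d u v} → Side a b c d u v → Side b c d a u v
  Side-rotate ab = da
  Side-rotate bc = ab
  Side-rotate cd = bc
  Side-rotate da = cd

  CycEdge-rotate : ∀ {a b c d u v} → CycEdge G (a ∷ b ∷ c ∷ d ∷ []) u v → CycEdge G (b ∷ c ∷ d ∷ a ∷ []) u v
  CycEdge-rotate e with CycEdge⇒SquareEdge e
  ... | inj₁ s = SquareEdge⇒CycEdge (inj₁ (Side-rotate s))
  ... | inj₂ s = SquareEdge⇒CycEdge (inj₂ (Side-rotate s))

  CycEdge-square⇒∈ : ∀ {a b c d u v} → CycEdge G (a ∷ b ∷ c ∷ d ∷ []) u v → u ∈ a ∷ b ∷ c ∷ d ∷ []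
  CycEdge-square⇒∈ e with CycEdge⇒SquareEdge e
  ... | inj₁ ab = here refl
  ... | inj₁ bc = there (here refl)
  ... | inj₁ cd = there (there (here refl))
  ... | inj₁ da = there (there (there (here refl)))
  ... | inj₂ ab = there (here refl)
  ... | inj₂ bc = there (there (here refl))
  ... | inj₂ cd = there (there (there (here refl)))
  ... | inj₂ da = here refl


  record Square (a b c d : Vtx G) : Set where
    field
      a≢b : a ≢ b
      a≢c : a ≢ c
      a≢d : a ≢ d
      b≢c : b ≢ c
      b≢d : b ≢ d
      c≢d : c ≢ d
      E-ab : E G a b
      E-bc : E G b c
      E-cd : E G c d
      E-da : E G d a
      a∈S : In G S a
      b∈S : In G S b
      c∈S : In G S c
      d∈S : In G S d

  In? : ∀ v → Dec (In G S v)
  In? v = S v ≟ᵇ true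

  ∈S⇒≢ : ∀ {u w} → In G S u → ¬ In G S w → u ≢ w
  ∈S⇒≢ u∈S w∉S refl = w∉S u∈S

  cycle⇒square : ∀ {a b c d} → CycleIn G S (a ∷ b ∷ c ∷ d ∷ []) → Square a b c d
  cycle⇒square ((_ , ((a≢b ∷ a≢c ∷ a≢d ∷ []) ∷ (b≢c ∷ b≢d ∷ []) ∷ (c≢d ∷ []) ∷ [] ∷ []) ,
                 (E-ab ∷ E-bc ∷ E-cd ∷ E-da ∷ [-])) , (a∈S ∷ b∈S ∷ c∈S ∷ d∈S ∷ [])) =
    record { a≢b = a≢b ; a≢c = a≢c ; a≢d = a≢d ; b≢c = b≢c ; b≢d = b≢d ; c≢d = c≢d
           ; E-ab = E-ab ; E-bc = E-bc ; E-cd = E-cd ; E-da = E-da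
           ; a∈S = a∈S ; b∈S = b∈S ; c∈S = c∈S ; d∈S = d∈S }

  square⇒cycle : ∀ {a b c d} → Square a b c d → CycleIn G S (a ∷ b ∷ c ∷ d ∷ [])
  square⇒cycle sq =
    (s≤s (s≤s (s≤s z≤n)) , ((a≢b ∷ a≢c ∷ a≢d ∷ []) ∷ (b≢c ∷ b≢d ∷ []) ∷ (c≢d ∷ []) ∷ [] ∷ []) ,
     (E-ab ∷ E-bc ∷ E-cd ∷ E-da ∷ [-])) , (a∈S ∷ b∈S ∷ c∈S ∷ d∈S ∷ [])
    where open Square sq

  Square-rotate : ∀ {a b c d} → Square a b c d → Square b c d a
  Square-rotate sq = record
    { a≢b = b≢c ; a≢c = b≢d ; a≢d = a≢b ∘ sym ; b≢c = c≢d ; b≢d = a≢c ∘ sym ; c≢d = a≢d ∘ sym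
    ; E-ab = E-bc ; E-bc = E-cd ; E-cd = E-da ; E-da = E-ab
    ; a∈S = b∈S ; b∈S = c∈S ; c∈S = d∈S ; d∈S = a∈S }
    where open Square sq

  Square-reflect : ∀ {a b c d} → Square a b c d → Square a d c b
  Square-reflect sq = record
    { a≢b = a≢d ; a≢c = a≢c ; a≢d = a≢b ; b≢c = c≢d ∘ sym ; b≢d = b≢d ∘ sym ; c≢d = b≢c ∘ sym
    ; E-ab = E-sym G E-da ; E-bc = E-sym G E-cd ; E-cd = E-sym G E-bc ; E-da = E-sym G E-ab
    ; a∈S = a∈S ; b∈S = d∈S ; c∈S = c∈S ; d∈S = b∈S }
    where open Square sq

  square-at : ∀ {p q r s w} → Square p q r s → w ∈ p ∷ q ∷ r ∷ s ∷ [] →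
    ∃[ b ] ∃[ c ] ∃[ d ] (Square w b c d ×
      (∀ {u v} → CycEdge G (p ∷ q ∷ r ∷ s ∷ []) u v → CycEdge G (w ∷ b ∷ c ∷ d ∷ []) u v))
  square-at sq (here refl)                         = _ , _ , _ , sq , λ e → e
  square-at sq (there (here refl))                 = _ , _ , _ , Square-rotate sq , λ e → CycEdge-rotate e
  square-at sq (there (there (here refl)))         =
    _ , _ , _ , Square-rotate (Square-rotate sq) , λ e → CycEdge-rotate (CycEdge-rotate e)
  square-at sq (there (there (there (here refl)))) =
    _ , _ , _ , Square-rotate (Square-rotate (Square-rotate sq)) , λ e → CycEdge-rotate (CycEdge-rotate (CycEdge-rotate e))

  square-neighbour : ∀ {a b c d e} → Square a b c d → CycEdge G (a ∷ b ∷ c ∷ d ∷ []) b e → e ≡ a ⊎ e ≡ c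
  square-neighbour sq be with CycEdge⇒SquareEdge be
  ... | inj₁ bc = inj₂ refl
  ... | inj₂ ab = inj₁ refl
  ... | inj₁ ab = ⊥-elim (Square.a≢b sq refl)
  ... | inj₁ cd = ⊥-elim (Square.b≢c sq refl)
  ... | inj₁ da = ⊥-elim (Square.b≢d sq refl)
  ... | inj₂ bc = ⊥-elim (Square.b≢c sq refl)
  ... | inj₂ cd = ⊥-elim (Square.b≢d sq refl)
  ... | inj₂ da = ⊥-elim (Square.a≢b sq refl)

module Bristled {G : Graph} {S : Vtx G → Bool} (bristles : Bristles G S) where
  open Graph G using (adj)
  open Squares {G} S using (In?)

  pendant : ∀ {v u w} → ¬ In G S v → E G v u → E G v w → u ≡ w
  pendant v∉S vu vw with _ , _ , unique ← proj₁ (proj₂ bristles) _ v∉S = trans (unique _ vu) (sym (unique _ vw))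

  middle∈S : ∀ {u v w} → E G u v → E G v w → u ≢ w → In G S v
  middle∈S {v = v} uv vw u≢w with In? v
  ... | yes v∈S = v∈S
  ... | no  v∉S = ⊥-elim (u≢w (pendant v∉S (E-sym G uv) vw))

  path-∈S : ∀ {p u z} → IsPath G p → head p ≡ just u → last p ≡ just z → In G S u → In G S z → All (In G S) p
  path-∈S {_ ∷ []}         _                                  refl refl u∈S _   = u∈S ∷ []
  path-∈S {_ ∷ _ ∷ []}     _                                  refl refl u∈S z∈S = u∈S ∷ z∈S ∷ []
  path-∈S {_ ∷ _ ∷ _ ∷ _}  ((_ ∷ u≢w ∷ _) ∷ unique , uv ∷ vw ∷ l) refl eq  u∈S z∈S =
    u∈S ∷ path-∈S (unique , vw ∷ l) refl eq (middle∈S uv vw u≢w) z∈S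

  single-vertex-acyclic : ∀ {x} → (∀ v → In G S v → v ≡ x) → ∀ c → ¬ IsCycle G c
  single-vertex-acyclic _ []           (() , _)
  single-vertex-acyclic _ (_ ∷ [])     (s≤s () , _)
  single-vertex-acyclic _ (_ ∷ _ ∷ []) (s≤s (s≤s ()) , _)
  single-vertex-acyclic only-x (v₀ ∷ v₁ ∷ v₂ ∷ rest)
    (_ , ((v₀≢v₁ ∷ v₀≢v₂ ∷ _) ∷ (v₁≢v₂ ∷ v₁∉rest) ∷ _) , (e₀₁ ∷ e₁₂ ∷ l)) =
    v₁≢v₂ (trans (only-x v₁ (middle∈S e₀₁ e₁₂ v₀≢v₂)) (sym (only-x v₂ (v₂∈S rest v₁∉rest l))))
    where
    v₂∈S : ∀ rest → All (v₁ ≢_) rest → Linked (E G) (v₂ ∷ rest ++ [ v₀ ]) → In G S v₂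
    v₂∈S []      _          (e ∷ _) = middle∈S e₁₂ e (v₀≢v₁ ∘ sym)
    v₂∈S (_ ∷ _) (v₁≢w ∷ _) (e ∷ _) = middle∈S e₁₂ e v₁≢w

  NoCommonCycle : Vtx G → Vtx G → Vtx G → Set
  NoCommonCycle y a v = ∀ c → CycleIn G S c → CycEdge G c y a → ¬ CycEdge G c a v

  FreshEdge : List (Vtx G) → Vtx G → Vtx G → Set
  FreshEdge P a v = P ≡ [ a ] ⊎ ∃[ P′ ] ∃[ y ] (P ≡ P′ ++ y ∷ a ∷ [] × NoCommonCycle y a v)

  no-return-path : ∀ {y a v} → NoCommonCycle y a v → E G a v → In G S a → In G S v →
                   ∀ L → ¬ IsPath G (v ∷ L ++ y ∷ a ∷ [])
  no-return-path {y} {a} {v} sep av a∈S v∈S L p with cycle , ya , av′ ← path-closes-to-cycle G L p av =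
    sep (v ∷ L ++ y ∷ a ∷ []) (cycle , path-∈S p refl (last-++-∷ʳ (v ∷ L) [ y ]) v∈S a∈S) ya av′

  suffix-from : ∀ {P′ y a z} → z ∈ P′ ++ y ∷ a ∷ [] → z ≢ a →
    Σ[ pre ∈ List (Vtx G) ] Σ[ K ∈ List (Vtx G) ]
      (P′ ++ y ∷ a ∷ [] ≡ pre ++ K ++ y ∷ a ∷ [] × head (K ++ y ∷ a ∷ []) ≡ just z)
  suffix-from {P′} {y} {a} z∈P z≢a with ∈-++⁻ P′ z∈P
  ... | inj₂ (here refl)         = P′ , [] , refl , refl
  ... | inj₂ (there (here refl)) = ⊥-elim (z≢a refl)
  ... | inj₁ z∈P′ with pre , L , refl ← ∈-∃++ z∈P′ = pre , _ ∷ L , ++-assoc pre (_ ∷ L) (y ∷ a ∷ []) , refl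

  fresh⇒∉ : ∀ {P a v} → IsPath G P → E G a v → In G S a → In G S v →
            (∃[ c ] (CycleIn G S c × CycEdge G c a v)) → FreshEdge P a v → v ∉ P
  fresh⇒∉ _ av _ _ _ (inj₁ refl) (here refl) = E-irrefl G av
  fresh⇒∉ p av a∈S v∈S (c , c-cycle , c-av) (inj₂ (P′ , y , refl , sep)) v∈P
    with suffix-from v∈P (E⇒≢ G av ∘ sym)
  ... | _   , []    , _  , refl = sep c c-cycle (swap c-av) c-av
  ... | pre , _ ∷ L , eq , refl = no-return-path sep av a∈S v∈S L (IsPath-++⁻ʳ G pre (subst (IsPath G) eq p))

  fresh⇒unique-shortest : ∀ {x P a v} → UniqueShortest G x a P → E G a v → In G S a → In G S v → v ∉ P →
                           FreshEdge P a v → UniqueShortest G x v (P ∷ʳ v)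
  fresh⇒unique-shortest {x} {P} {a} {v} ((p , head≡x , last≡a) , P-shortest) av a∈S v∈S v∉P fresh =
    (IsPath-∷ʳ G p last≡a av v∉P , head-++ head≡x , last-∷ʳ P) , shortest
    where
    split-length : ∀ q₁ r → length (q₁ ++ a ∷ r) ≤ length (P ∷ʳ v) → length (q₁ ∷ʳ a) + length r ≤ length P + 1
    split-length q₁ r = subst₂ _≤_ (trans (cong length (sym (∷ʳ-++ q₁ a r))) (length-++ (q₁ ∷ʳ a))) (length-++ P)

    prefix≡P : ∀ q₁ h t → IsPath G (q₁ ++ a ∷ h ∷ t) → head (q₁ ++ a ∷ h ∷ t) ≡ just x →
               length (q₁ ++ a ∷ h ∷ t) ≤ length (P ∷ʳ v) → q₁ ∷ʳ a ≡ P
    prefix≡P q₁ h t q-path head-q q-short = P-shortest (q₁ ∷ʳ a)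
      (IsPath-++⁻ˡ G (q₁ ∷ʳ a) (subst (IsPath G) (sym (∷ʳ-++ q₁ a (h ∷ t))) q-path) ,
       trans (sym (head-++-∷ q₁)) head-q , last-∷ʳ q₁)
      (+-cancelʳ-≤ 1 _ _ (≤-trans (+-monoʳ-≤ (length (q₁ ∷ʳ a)) (s≤s z≤n)) (split-length q₁ (h ∷ t) q-short)))

    through-a : ∀ q₁ h t → IsPath G (q₁ ++ a ∷ h ∷ t) → head (q₁ ++ a ∷ h ∷ t) ≡ just x → last (h ∷ t) ≡ just v →
                length (q₁ ++ a ∷ h ∷ t) ≤ length (P ∷ʳ v) → q₁ ++ a ∷ h ∷ t ≡ P ∷ʳ v
    through-a q₁ h [] q-path head-q refl q-short =
      trans (sym (∷ʳ-++ q₁ a [ v ])) (cong (_∷ʳ v) (prefix≡P q₁ h [] q-path head-q q-short))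
    through-a q₁ h (w ∷ t) q-path head-q _ q-short
      with s≤s () ← +-cancelˡ-≤ (length P) _ 1
                  (subst (λ l → length l + length (h ∷ w ∷ t) ≤ length P + 1)
                         (prefix≡P q₁ h (w ∷ t) q-path head-q q-short) (split-length q₁ (h ∷ w ∷ t) q-short))

    elsewhere : ∀ q₁ z h t → IsPath G (q₁ ++ z ∷ h ∷ t) → last (h ∷ t) ≡ just v → z ∈ P → z ≢ a →
                All (_∉ P) (h ∷ t) → FreshEdge P a v → ⊥
    elsewhere q₁ z h t q-path last-r z∈P z≢a r∉P (inj₁ P≡a) = z≢a (Anyₚ.singleton⁻ (subst (z ∈_) P≡a z∈P))
    elsewhere q₁ z h t q-path last-r z∈P z≢a r∉P (inj₂ (P′ , y , P≡ , sep))
      with pre , K , eqP , head-seg ← suffix-from (subst (z ∈_) P≡ z∈P) z≢a =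
      no-return-path sep av a∈S v∈S (reverse R ++ K) (subst (IsPath G) cycle≡ glued)
      where
      seg⊆P : ∀ {w} → w ∈ K ++ y ∷ a ∷ [] → w ∈ P
      seg⊆P m = subst (_ ∈_) (sym (trans P≡ eqP)) (∈-++⁺ʳ pre m)
      glued : IsPath G (reverse (h ∷ t) ++ K ++ y ∷ a ∷ [])
      glued = IsPath-reverse-++ G (IsPath-++⁻ʳ G q₁ q-path)
                (IsPath-++⁻ʳ G pre (subst (IsPath G) (trans P≡ eqP) p)) head-seg
                (λ w∈r w∈seg → All.lookup r∉P w∈r (seg⊆P w∈seg))
      R : List (Vtx G)
      R = proj₁ (last⇒∷ʳ (h ∷ t) last-r)
      cycle≡ : reverse (h ∷ t) ++ K ++ y ∷ a ∷ [] ≡ v ∷ (reverse R ++ K) ++ y ∷ a ∷ []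
      cycle≡ = trans (cong (λ l → reverse l ++ K ++ y ∷ a ∷ []) (proj₂ (last⇒∷ʳ (h ∷ t) last-r)))
               (trans (cong (_++ K ++ y ∷ a ∷ []) (reverse-++ R [ v ]))
                      (cong (v ∷_) (sym (++-assoc (reverse R) K (y ∷ a ∷ [])))))

    -- A competing path q leaves P for the last time at some z. If z = a then q = P v by uniqueness of P;
    -- otherwise the rest of q, reversed, followed by the segment of P from z closes a cycle through y a v.
    shortest : ∀ q → PathFromTo G x v q → length q ≤ length (P ∷ʳ v) → q ≡ P ∷ʳ v
    shortest q (q-path , head-q , last-q) q-short
      with split-at-last (λ w → any? (w ≟_) P) (head⇒Any head-q (head⇒Any head≡x refl))
    ... | q₁ , z , [] , refl , z∈P , _ =
      ⊥-elim (v∉P (subst (_∈ P) (just-injective (trans (sym (last-∷ʳ q₁)) last-q)) z∈P))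
    ... | q₁ , z , h ∷ t , refl , z∈P , r∉P with z ≟ a
    ...   | yes refl = through-a q₁ h t q-path head-q (trans (sym (last-++-∷ q₁ (h ∷ t))) last-q) q-short
    ...   | no z≢a   =
      ⊥-elim (elsewhere q₁ z h t q-path (trans (sym (last-++-∷ q₁ (h ∷ t))) last-q) z∈P z≢a r∉P fresh)

  data Neighbourhood (b a c : Vtx G) : Set where
    exit     : ∀ {e} → E G b e → In G S e → e ≢ a → e ≢ c → Neighbourhood b a c
    bare     : (∀ {w} → E G b w → w ≡ a ⊎ w ≡ c) → Neighbourhood b a c
    bristled : ∀ {w} → E G b w → ¬ In G S w → (∀ {w′} → E G b w′ → w′ ≡ a ⊎ w′ ≡ c ⊎ w′ ≡ w) → Neighbourhood b a c

  private
    NoExit : Vtx G → Vtx G → Vtx G → Set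
    NoExit b a c = ¬ ∃ λ e → E G b e × In G S e × e ≢ a × e ≢ c

    square-side : ∀ {b a c w} → NoExit b a c → E G b w → In G S w → w ≡ a ⊎ w ≡ c
    square-side {a = a} {c} {w} no-exit bw w∈S with w ≟ a | w ≟ c
    ... | yes w≡a | _       = inj₁ w≡a
    ... | no _    | yes w≡c = inj₂ w≡c
    ... | no w≢a  | no w≢c  = ⊥-elim (no-exit (w , bw , w∈S , w≢a , w≢c))

    bristle-or-side : ∀ {b a c w w′} → In G S b → NoExit b a c → E G b w → ¬ In G S w → E G b w′ →
                      w′ ≡ a ⊎ w′ ≡ c ⊎ w′ ≡ w
    bristle-or-side {b} {w = w} {w′} b∈S no-exit bw w∉S bw′ with In? w′
    ... | yes w′∈S = Sum.map₂ inj₁ (square-side no-exit bw′ w′∈S)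
    ... | no w′∉S  = inj₂ (inj₂ (proj₂ (proj₂ bristles) b w′ w b∈S w′∉S w∉S bw′ bw))

  neighbourhood : ∀ b a c → In G S b → Neighbourhood b a c
  neighbourhood b a c b∈S
    with Fin.any? (λ e → (adj b e ≟ᵇ true) ×-dec In? e ×-dec ¬? (e ≟ a) ×-dec ¬? (e ≟ c))
  ... | yes (_ , be , e∈S , e≢a , e≢c) = exit be e∈S e≢a e≢c
  ... | no no-exit with Fin.any? (λ w → (adj b w ≟ᵇ true) ×-dec ¬? (In? w))
  ...   | yes (_ , bw , w∉S) = bristled bw w∉S (bristle-or-side b∈S no-exit bw w∉S)
  ...   | no no-bristle      =
    bare (λ {w} bw → square-side no-exit bw (decidable-stable (In? w) (λ w∉S → no-bristle (w , bw , w∉S))))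

module _ {n : ℕ} where

  transpose-i : ∀ (i j : Fin n) → transpose i j i ≡ j
  transpose-i i _ rewrite dec-true (i ≟ i) refl = refl

  transpose-j : ∀ (i j : Fin n) → transpose i j j ≡ i
  transpose-j i j with i ≟ j
  ... | yes refl = transpose-i i i
  ... | no i≢j rewrite dec-false (j ≟ i) (i≢j ∘ sym) | dec-true (j ≟ j) refl = refl

  transpose-k : ∀ (i j : Fin n) {k} → k ≢ i → k ≢ j → transpose i j k ≡ k
  transpose-k i j {k} k≢i k≢j rewrite dec-false (k ≟ i) k≢i | dec-false (k ≟ j) k≢j = refl

  data Position (i j : Fin n) : Fin n → Set where
    at-i : Position i j i
    at-j : Position i j j
    off  : ∀ {k} → k ≢ i → k ≢ j → Position i j k

  position : ∀ i j k → Position i j k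
  position i j k with k ≟ i | k ≟ j
  ... | yes refl | _        = at-i
  ... | no _     | yes refl = at-j
  ... | no k≢i   | no k≢j   = off k≢i k≢j

  transpose-involutive : ∀ (i j : Fin n) k → transpose i j (transpose i j k) ≡ k
  transpose-involutive i j k with position i j k
  ... | at-i        = trans (cong (transpose i j) (transpose-i i j)) (transpose-j i j)
  ... | at-j        = trans (cong (transpose i j) (transpose-j i j)) (transpose-i i j)
  ... | off k≢i k≢j = trans (cong (transpose i j) (transpose-k i j k≢i k≢j)) (transpose-k i j k≢i k≢j)

module _ (G : Graph) where

  involution⇒¬InvolutionFree : ∀ {x v} (σ : Vtx G → Vtx G) → (∀ u → σ (σ u) ≡ u) →
    (∀ {u w} → E G u w → E G (σ u) (σ w)) → σ x ≡ x → σ v ≢ v → ¬ InvolutionFree G x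
  involution⇒¬InvolutionFree {v = v} σ σσ≡id σ-edge σx≡x σv≢v free =
    free (σ , σσ≡id , (v , σv≢v) , σx≡x ,
          λ u w → ⇔→≡ (mk⇔ (λ e → subst₂ (E G) (σσ≡id u) (σσ≡id w) (σ-edge e)) σ-edge))

  twins⇒¬InvolutionFree : ∀ {x b d} → b ≢ d → x ≢ b → x ≢ d →
    (∀ {w} → E G b w → E G d w) → (∀ {w} → E G d w → E G b w) → ¬ InvolutionFree G x
  twins⇒¬InvolutionFree {x} {b} {d} b≢d x≢b x≢d b→d d→b =
    involution⇒¬InvolutionFree {v = b} σ (transpose-involutive b d) σ-edge (transpose-k b d x≢b x≢d)
      (λ σb≡b → b≢d (trans (sym σb≡b) σb≡d))
    where
    σ : Vtx G → Vtx G
    σ = transpose b d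
    σb≡d : σ b ≡ d
    σb≡d = transpose-i b d
    σd≡b : σ d ≡ b
    σd≡b = transpose-j b d
    σ-off : ∀ {v} → v ≢ b → v ≢ d → σ v ≡ v
    σ-off = transpose-k b d
    σ-edge : ∀ {u w} → E G u w → E G (σ u) (σ w)
    σ-edge {u} {w} e with position b d u | position b d w
    ... | at-i        | at-i        = ⊥-elim (E-irrefl G e)
    ... | at-i        | at-j        = ⊥-elim (E-irrefl G (b→d e))
    ... | at-i        | off w≢b w≢d = E-resp G σb≡d (σ-off w≢b w≢d) (b→d e)
    ... | at-j        | at-i        = ⊥-elim (E-irrefl G (d→b e))
    ... | at-j        | at-j        = ⊥-elim (E-irrefl G e)
    ... | at-j        | off w≢b w≢d = E-resp G σd≡b (σ-off w≢b w≢d) (d→b e)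
    ... | off u≢b u≢d | at-i        = E-resp G (σ-off u≢b u≢d) σb≡d (E-sym G (b→d (E-sym G e)))
    ... | off u≢b u≢d | at-j        = E-resp G (σ-off u≢b u≢d) σd≡b (E-sym G (d→b (E-sym G e)))
    ... | off u≢b u≢d | off w≢b w≢d = E-resp G (σ-off u≢b u≢d) (σ-off w≢b w≢d) e

  pendant-twins⇒¬InvolutionFree : ∀ {x b d b′ d′} →
    b ≢ d → b ≢ d′ → d ≢ b′ → x ≢ b → x ≢ d → x ≢ b′ → x ≢ d′ →
    E G b b′ → E G d d′ → (∀ {w} → E G b′ w → w ≡ b) → (∀ {w} → E G d′ w → w ≡ d) →
    (∀ {w} → w ≢ b′ → E G b w → E G d w) → (∀ {w} → w ≢ d′ → E G d w → E G b w) →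
    ¬ InvolutionFree G x
  pendant-twins⇒¬InvolutionFree {x} {b} {d} {b′} {d′} b≢d b≢d′ d≢b′ x≢b x≢d x≢b′ x≢d′
    bb′ dd′ b′-pendant d′-pendant b→d d→b =
    involution⇒¬InvolutionFree {v = b} σ σ-involutive σ-edge (σ-off x≢b x≢d x≢b′ x≢d′)
      (λ σb≡b → b≢d (trans (sym σb≡b) σb≡d))
    where
    σ : Vtx G → Vtx G
    σ = transpose b d ∘ transpose b′ d′

    b′≢b : b′ ≢ b
    b′≢b = E⇒≢ G (E-sym G bb′)
    d′≢d : d′ ≢ d
    d′≢d = E⇒≢ G (E-sym G dd′)

    σb≡d : σ b ≡ d
    σb≡d = trans (cong (transpose b d) (transpose-k b′ d′ (b′≢b ∘ sym) b≢d′)) (transpose-i b d)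
    σd≡b : σ d ≡ b
    σd≡b = trans (cong (transpose b d) (transpose-k b′ d′ d≢b′ (d′≢d ∘ sym))) (transpose-j b d)
    σb′≡d′ : σ b′ ≡ d′
    σb′≡d′ = trans (cong (transpose b d) (transpose-i b′ d′)) (transpose-k b d (b≢d′ ∘ sym) d′≢d)
    σd′≡b′ : σ d′ ≡ b′
    σd′≡b′ = trans (cong (transpose b d) (transpose-j b′ d′)) (transpose-k b d b′≢b (d≢b′ ∘ sym))
    σ-off : ∀ {v} → v ≢ b → v ≢ d → v ≢ b′ → v ≢ d′ → σ v ≡ v
    σ-off v≢b v≢d v≢b′ v≢d′ = trans (cong (transpose b d) (transpose-k b′ d′ v≢b′ v≢d′)) (transpose-k b d v≢b v≢d)

    data Place : Vtx G → Set where
      at-b      : Place b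
      at-d      : Place d
      at-b′     : Place b′
      at-d′     : Place d′
      elsewhere : ∀ {v} → v ≢ b → v ≢ d → v ≢ b′ → v ≢ d′ → Place v

    place : ∀ v → Place v
    place v with position b d v | position b′ d′ v
    ... | at-i        | _             = at-b
    ... | at-j        | _             = at-d
    ... | off _ _     | at-i          = at-b′
    ... | off _ _     | at-j          = at-d′
    ... | off v≢b v≢d | off v≢b′ v≢d′ = elsewhere v≢b v≢d v≢b′ v≢d′

    σ-involutive : ∀ v → σ (σ v) ≡ v
    σ-involutive v with place v
    ... | at-b                    = trans (cong σ σb≡d) σd≡b
    ... | at-d                    = trans (cong σ σd≡b) σb≡d
    ... | at-b′                   = trans (cong σ σb′≡d′) σd′≡b′
    ... | at-d′                   = trans (cong σ σd′≡b′) σb′≡d′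
    ... | elsewhere v≢b v≢d v≢b′ v≢d′ = trans (cong σ (σ-off v≢b v≢d v≢b′ v≢d′)) (σ-off v≢b v≢d v≢b′ v≢d′)

    σ-edge : ∀ {u w} → E G u w → E G (σ u) (σ w)
    σ-edge {u} {w} e with place u | place w
    ... | at-b  | at-b  = ⊥-elim (E-irrefl G e)
    ... | at-b  | at-d  = ⊥-elim (E-irrefl G (b→d (d≢b′) e))
    ... | at-b  | at-b′ = E-resp G σb≡d σb′≡d′ dd′
    ... | at-b  | at-d′ = ⊥-elim (b≢d (d′-pendant (E-sym G e)))
    ... | at-b  | elsewhere w≢b w≢d w≢b′ w≢d′ = E-resp G σb≡d (σ-off w≢b w≢d w≢b′ w≢d′) (b→d w≢b′ e)
    ... | at-d  | at-b  = ⊥-elim (E-irrefl G (d→b b≢d′ e))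
    ... | at-d  | at-d  = ⊥-elim (E-irrefl G e)
    ... | at-d  | at-b′ = ⊥-elim (b≢d (sym (b′-pendant (E-sym G e))))
    ... | at-d  | at-d′ = E-resp G σd≡b σd′≡b′ bb′
    ... | at-d  | elsewhere w≢b w≢d w≢b′ w≢d′ = E-resp G σd≡b (σ-off w≢b w≢d w≢b′ w≢d′) (d→b w≢d′ e)
    ... | at-b′ | _ with refl ← b′-pendant e = E-resp G σb′≡d′ σb≡d (E-sym G dd′)
    ... | at-d′ | _ with refl ← d′-pendant e = E-resp G σd′≡b′ σd≡b (E-sym G bb′)
    ... | elsewhere u≢b u≢d u≢b′ u≢d′ | at-b  =
      E-resp G (σ-off u≢b u≢d u≢b′ u≢d′) σb≡d (E-sym G (b→d u≢b′ (E-sym G e)))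
    ... | elsewhere u≢b u≢d u≢b′ u≢d′ | at-d  =
      E-resp G (σ-off u≢b u≢d u≢b′ u≢d′) σd≡b (E-sym G (d→b u≢d′ (E-sym G e)))
    ... | elsewhere u≢b _ _ _ | at-b′ = ⊥-elim (u≢b (b′-pendant (E-sym G e)))
    ... | elsewhere _ u≢d _ _ | at-d′ = ⊥-elim (u≢d (d′-pendant (E-sym G e)))
    ... | elsewhere u≢b u≢d u≢b′ u≢d′ | elsewhere w≢b w≢d w≢b′ w≢d′ =
      E-resp G (σ-off u≢b u≢d u≢b′ u≢d′) (σ-off w≢b w≢d w≢b′ w≢d′) e

module Traversal {G : Graph} {x : Vtx G} {S : Vtx G → Bool} (bristles : Bristles G S) (x∈S : In G S x)
         (cactus : CactusIn G S) (squares : UnionOf4CyclesIn G S) (free : InvolutionFree G x) where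
  open Graph G using (n)
  open Squares {G} S
  open Bristled {G} {S} bristles

  EntersSquare : List (Vtx G) → Vtx G → Vtx G → Vtx G → Vtx G → Set
  EntersSquare P a b c d =
    P ≡ [ a ] ⊎ ∃[ P′ ] ∃[ y ] (P ≡ P′ ++ y ∷ a ∷ [] × ¬ CycEdge G (a ∷ b ∷ c ∷ d ∷ []) y a)

  square-through : ∀ {v e} → In G S v → In G S e → E G v e →
    ∃[ b ] ∃[ c ] ∃[ d ] (Square v b c d × CycEdge G (v ∷ b ∷ c ∷ d ∷ []) v e)
  square-through {v} {e} v∈S e∈S ve with proj₂ squares v e v∈S e∈S ve
  ... | _ ∷ _ ∷ _ ∷ _ ∷ [] , cycle , refl , edge
    with b , c , d , sq , moved ← square-at (cycle⇒square cycle) (CycEdge-square⇒∈ edge) =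
    b , c , d , sq , moved edge

  square-at-root : ∃[ b ] ∃[ c ] ∃[ d ] Square x b c d
  square-at-root with proj₁ squares x x∈S
  ... | _ ∷ _ ∷ _ ∷ _ ∷ [] , cycle , refl , x∈c with b , c , d , sq , _ ← square-at (cycle⇒square cycle) x∈c =
    b , c , d , sq

  entering⇒fresh : ∀ {P a b c d v} → Square a b c d → EntersSquare P a b c d → E G a v → In G S v →
                   CycEdge G (a ∷ b ∷ c ∷ d ∷ []) a v → FreshEdge P a v
  entering⇒fresh _  (inj₁ P≡a)                  _  _   _     = inj₁ P≡a
  entering⇒fresh sq (inj₂ (P′ , y , P≡ , ¬ya)) av v∈S sq-av = inj₂ (P′ , y , P≡ , λ c c-cycle c-ya c-av →
    ¬ya (proj₁ (proj₂ cactus _ _ (Square.a∈S sq) v∈S av c _ c-cycle (square⇒cycle sq) c-av sq-av _ _) c-ya))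

  extend : ∀ {P a b c d v} → UniqueShortest G x a P → Square a b c d → EntersSquare P a b c d →
           E G a v → In G S v → CycEdge G (a ∷ b ∷ c ∷ d ∷ []) a v → v ∉ P × UniqueShortest G x v (P ∷ʳ v)
  extend {P} {a} {v = v} P-shortest sq enters av v∈S sq-av =
    v∉P , fresh⇒unique-shortest P-shortest av (Square.a∈S sq) v∈S v∉P fresh
    where
    fresh : FreshEdge P a v
    fresh = entering⇒fresh sq enters av v∈S sq-av
    v∉P : v ∉ P
    v∉P = fresh⇒∉ (proj₁ (proj₁ P-shortest)) av (Square.a∈S sq) v∈S (_ , square⇒cycle sq , sq-av) fresh

  record Frontier : Set where
    constructor frontier
    field
      path          : List (Vtx G)
      a b c d       : Vtx G
      path-shortest : UniqueShortest G x a path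
      square        : Square a b c d
      enters        : EntersSquare path a b c d
  open Frontier using (path; path-shortest)

  FrontierBeyond : List (Vtx G) → Set
  FrontierBeyond P = Σ[ F ∈ Frontier ] length (path F) ≡ suc (length P)

  exit-frontier : ∀ {P a v c d e} → last P ≡ just a → Square a v c d → UniqueShortest G x v (P ∷ʳ v) →
                  E G v e → In G S e → e ≢ a → e ≢ c → FrontierBeyond P
  exit-frontier {P} {a} {v} {c} {d} {e} last≡a sq v-shortest ve e∈S e≢a e≢c
    with b′ , c′ , d′ , sq′ , sq′-ve ← square-through (Square.b∈S sq) e∈S ve
    with P₀ , P≡ ← last⇒∷ʳ P last≡a =
    frontier (P ∷ʳ v) v b′ c′ d′ v-shortest sq′ (inj₂ (P₀ , a , P∷ʳv≡ , leaves)) , length-∷ʳ P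
    where
    open Square sq
    P∷ʳv≡ : P ∷ʳ v ≡ P₀ ++ a ∷ v ∷ []
    P∷ʳv≡ = trans (cong (_∷ʳ v) P≡) (∷ʳ-++ P₀ a [ v ])
    leaves : ¬ CycEdge G (v ∷ b′ ∷ c′ ∷ d′ ∷ []) a v
    leaves sq′-av with proj₁ (proj₂ cactus a v a∈S b∈S E-ab _ _ (square⇒cycle sq′) (square⇒cycle sq)
                                  sq′-av (SquareEdge⇒CycEdge (inj₁ ab)) v e) sq′-ve
    ... | ve∈sq with square-neighbour sq ve∈sq
    ...   | inj₁ e≡a = e≢a e≡a
    ...   | inj₂ e≡c = e≢c e≡c

  bare-twins : ∀ {a b c d} → Square a b c d → x ≢ b → x ≢ d →
    (∀ {w} → E G b w → w ≡ a ⊎ w ≡ c) → (∀ {w} → E G d w → w ≡ a ⊎ w ≡ c) → ⊥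
  bare-twins {b = b} {d = d} sq x≢b x≢d N[b] N[d] = twins⇒¬InvolutionFree G b≢d x≢b x≢d b→d d→b free
    where
    open Square sq
    b→d : ∀ {w} → E G b w → E G d w
    b→d bw = case N[b] bw of λ where
      (inj₁ refl) → E-da
      (inj₂ refl) → E-sym G E-cd
    d→b : ∀ {w} → E G d w → E G b w
    d→b dw = case N[d] dw of λ where
      (inj₁ refl) → E-sym G E-ab
      (inj₂ refl) → E-bc

  bristled-twins : ∀ {a b c d b′ d′} → Square a b c d → x ≢ b → x ≢ d →
    E G b b′ → ¬ In G S b′ → (∀ {w} → E G b w → w ≡ a ⊎ w ≡ c ⊎ w ≡ b′) →
    E G d d′ → ¬ In G S d′ → (∀ {w} → E G d w → w ≡ a ⊎ w ≡ c ⊎ w ≡ d′) → ⊥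
  bristled-twins {b = b} {d = d} {b′} {d′} sq x≢b x≢d bb′ b′∉S N[b] dd′ d′∉S N[d] =
    pendant-twins⇒¬InvolutionFree G b≢d (∈S⇒≢ b∈S d′∉S) (∈S⇒≢ d∈S b′∉S) x≢b x≢d
      (∈S⇒≢ x∈S b′∉S) (∈S⇒≢ x∈S d′∉S)
      bb′ dd′ (λ b′w → pendant b′∉S b′w (E-sym G bb′)) (λ d′w → pendant d′∉S d′w (E-sym G dd′)) b→d d→b free
    where
    open Square sq
    b→d : ∀ {w} → w ≢ b′ → E G b w → E G d w
    b→d w≢b′ bw = case N[b] bw of λ where
      (inj₁ refl)        → E-da
      (inj₂ (inj₁ refl)) → E-sym G E-cd
      (inj₂ (inj₂ w≡b′)) → ⊥-elim (w≢b′ w≡b′)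
    d→b : ∀ {w} → w ≢ d′ → E G d w → E G b w
    d→b w≢d′ dw = case N[d] dw of λ where
      (inj₁ refl)        → E-sym G E-ab
      (inj₂ (inj₁ refl)) → E-bc
      (inj₂ (inj₂ w≡d′)) → ⊥-elim (w≢d′ w≡d′)

  bare-and-bristled : ∀ {P a b c d w} → UniqueShortest G x a P → Square a b c d →
    (∀ {w′} → E G b w′ → w′ ≡ a ⊎ w′ ≡ c) →
    E G d w → ¬ In G S w → (∀ {w′} → E G d w′ → w′ ≡ a ⊎ w′ ≡ c ⊎ w′ ≡ w) →
    UniqueShortest G x b (P ∷ʳ b) → UniqueShortest G x d (P ∷ʳ d) → Has23Path G x
  bare-and-bristled P-shortest sq N[b] dw w∉S N[d] =
    Has23Path-intro G P-shortest (proj₁ (square⇒cycle sq)) (there (here refl)) (there (there (there (here refl))))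
      E-ab (E-sym G E-da) (degree-2 G (E-sym G E-ab) E-bc a≢c N[b])
      (degree-3 G E-da (E-sym G E-cd) dw a≢c (∈S⇒≢ a∈S w∉S) (∈S⇒≢ c∈S w∉S) N[d])
    where open Square sq

  step : (F : Frontier) → Has23Path G x ⊎ FrontierBeyond (path F)
  step (frontier P a b c d P-shortest sq enters) = continue (neighbourhood b a c b∈S) (neighbourhood d a c d∈S)
    where
    open Square sq
    last≡a : last P ≡ just a
    last≡a = proj₂ (proj₂ (proj₁ P-shortest))
    b-extended : b ∉ P × UniqueShortest G x b (P ∷ʳ b)
    b-extended = extend P-shortest sq enters E-ab b∈S (SquareEdge⇒CycEdge (inj₁ ab))
    d-extended : d ∉ P × UniqueShortest G x d (P ∷ʳ d)
    d-extended = extend P-shortest sq enters (E-sym G E-da) d∈S (SquareEdge⇒CycEdge (inj₂ da))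

    x∈P : x ∈ P
    x∈P = head⇒Any (proj₁ (proj₂ (proj₁ P-shortest))) refl
    x≢b : x ≢ b
    x≢b x≡b = proj₁ b-extended (subst (_∈ P) x≡b x∈P)
    x≢d : x ≢ d
    x≢d x≡d = proj₁ d-extended (subst (_∈ P) x≡d x∈P)

    continue : Neighbourhood b a c → Neighbourhood d a c → Has23Path G x ⊎ FrontierBeyond P
    continue (exit be e∈S e≢a e≢c) _ =
      inj₂ (exit-frontier last≡a sq (proj₂ b-extended) be e∈S e≢a e≢c)
    continue _ (exit de e∈S e≢a e≢c) =
      inj₂ (exit-frontier last≡a (Square-reflect sq) (proj₂ d-extended) de e∈S e≢a e≢c)
    continue (bare N[b]) (bare N[d]) = ⊥-elim (bare-twins sq x≢b x≢d N[b] N[d])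
    continue (bare N[b]) (bristled dw w∉S N[d]) =
      inj₁ (bare-and-bristled P-shortest sq N[b] dw w∉S N[d] (proj₂ b-extended) (proj₂ d-extended))
    continue (bristled bw w∉S N[b]) (bare N[d]) =
      inj₁ (bare-and-bristled P-shortest (Square-reflect sq) N[d] bw w∉S N[b] (proj₂ d-extended) (proj₂ b-extended))
    continue (bristled bb′ b′∉S N[b]) (bristled dd′ d′∉S N[d]) =
      ⊥-elim (bristled-twins sq x≢b x≢d bb′ b′∉S N[b] dd′ d′∉S N[d])

  -- k is fuel: each step lengthens the path, and paths have at most n vertices.
  walk : ∀ k (F : Frontier) → n < length (path F) + k → Has23Path G x
  walk zero    F n<|P| =
    ⊥-elim (<⇒≱ n<|P| (subst (_≤ n) (sym (+-identityʳ _)) (length-≤-n G (proj₁ (proj₁ (path-shortest F))))))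
  walk (suc k) F n<|P|+k with step F
  ... | inj₁ found        = found
  ... | inj₂ (F′ , |F′|≡) =
    walk k F′ (subst (n <_) (trans (+-suc (length (path F)) k) (cong (_+ k) (sym |F′|≡))) n<|P|+k)

  has-23-path : Has23Path G x
  has-23-path with b , c , d , sq ← square-at-root =
    walk n (frontier [ x ] x b c d (root-shortest G) sq (inj₁ refl)) ≤-refl

lemma5p3 : (G : Graph) (x : Fin (Graph.n G)) →
    InvolutionFree G x → ProperMosaic G x → Has23Path G x
lemma5p3 G x free ((S , x∈S , inj₁ only-x , bristles) , c , c-cycle) =
  ⊥-elim (Bristled.single-vertex-acyclic {G} {S} bristles (λ v → proj₁ (only-x v)) c c-cycle)
lemma5p3 G x free ((S , x∈S , inj₂ (_ , cactus , squares) , bristles) , _) =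
  Traversal.has-23-path {G} {x} {S} bristles x∈S cactus squares free
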